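{- Let $m\ge 3$, let $n \ge 6$ be even, let $\ell\in\mathbb{Z}_n$ have the same parity as $m$, and let $k_0 = 1, k_1,\dots,k_{m-1} \in \mathbb{Z}_n$ all be coprime to $n$. Let $\Gamma = \mathcal{X}_a(m,n,[k_0,\dots,k_{m-1}],\ell)$ and assume there exists a vertex-transitive subgroup $G \le \mathrm{Aut}(\Gamma)$ preserving the $2$-factor $\mathcal{C}$. Then $2k_i^2 \in \{2,-2\}$ for all $i \in \mathbb{Z}_m$. Moreover, if $2\ell \ne 0$, then $2k_i^2 = 2$ for all $i \in \mathbb{Z}_m$.
   Context: $\mathcal{X}_a(m,n,[k_0,\dots,k_{m-1}],\ell)$ is the graph with vertices $u_{i,j}$ ($i\in\mathbb{Z}_m$, $j\in\mathbb{Z}_n$) and edges: $u_{i,j}u_{i,j+k_i}$ for all $i,j$ (so $u_{i,j}\sim u_{i,j\pm k_i}$); $u_{i,j}u_{i+1,j}$ for integers $0\le i\le m-2$ and $j\equiv i\pmod 2$; $u_{m-1,j}u_{0,j+\ell}$ for $j\equiv m-1\pmod 2$. For $i\in\mathbb{Z}_m$, $V_i=\{u_{i,j}: j\in\mathbb{Z}_n\}$, $C_i$ is the $n$-cycle induced on $V_i$, and $\mathcal{C}=\{C_i\}$. A group preserves $\mathcal{C}$ if it maps cycles of $\mathcal{C}$ to cycles of $\mathcal{C}$. All arithmetic on $k_i,\ell$ is in $\mathbb{Z}_n$. -}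

module Defs where

open import Data.Nat using (ℕ; zero; suc; _+_; _*_; _∸_; _<_; _≤_; NonZero)
open import Data.Nat.DivMod using (_%_; m%n<n)
open import Data.Fin using (Fin; toℕ; fromℕ<)
open import Data.Product using (_×_; _,_; Σ; ∃)
open import Data.Sum using (_⊎_)
open import Relation.Binary.PropositionalEquality using (_≡_)
open import Function using (_∘_; id)

module _ {n : ℕ} {{_ : NonZero n}} where
  toZ : ℕ → Fin n
  toZ a = fromℕ< (m%n<n a n)

  _⊕_ : Fin n → Fin n → Fin n
  a ⊕ b = toZ (toℕ a + toℕ b)

  _⊗_ : Fin n → Fin n → Fin n
  a ⊗ b = toZ (toℕ a * toℕ b)

  ⊖_ : Fin n → Fin n
  ⊖ a = toZ (n ∸ toℕ a)

Vertex : ℕ → ℕ → Set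
Vertex m n = Fin m × Fin n

-- Directed arcs generating the edge set of X_a(m,n,[k_0..k_{m-1}],ℓ).
-- (Parity of j ∈ ℤ_n is that of its residue; well defined since n is even.)
data Arc (m n : ℕ) {{_ : NonZero n}} (k : Fin m → Fin n) (ℓ : Fin n)
     : Vertex m n → Vertex m n → Set where
  cyc  : ∀ i j → Arc m n k ℓ (i , j) (i , j ⊕ k i)
  rung : ∀ i j (p : suc (toℕ i) < m) → toℕ j % 2 ≡ toℕ i % 2 →
         Arc m n k ℓ (i , j) (fromℕ< p , j)
  wrap : ∀ i i₀ j → suc (toℕ i) ≡ m → toℕ i₀ ≡ 0 → toℕ j % 2 ≡ toℕ i % 2 →
         Arc m n k ℓ (i , j) (i₀ , j ⊕ ℓ)

Adj : (m n : ℕ) {{_ : NonZero n}} (k : Fin m → Fin n) (ℓ : Fin n) →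
      Vertex m n → Vertex m n → Set
Adj m n k ℓ u v = Arc m n k ℓ u v ⊎ Arc m n k ℓ v u

record Aut (m n : ℕ) {{_ : NonZero n}} (k : Fin m → Fin n) (ℓ : Fin n) : Set where
  field
    fun     : Vertex m n → Vertex m n
    inv     : Vertex m n → Vertex m n
    inv-l   : ∀ u → inv (fun u) ≡ u
    inv-r   : ∀ u → fun (inv u) ≡ u
    pres    : ∀ u v → Adj m n k ℓ u v → Adj m n k ℓ (fun u) (fun v)
    refl'   : ∀ u v → Adj m n k ℓ (fun u) (fun v) → Adj m n k ℓ u v
open Aut public

module _ {m n : ℕ} {{_ : NonZero n}} {k : Fin m → Fin n} {ℓ : Fin n} where
  idAut : Aut m n k ℓ
  idAut = record { fun = id ; inv = id ; inv-l = λ _ → Relation.Binary.PropositionalEquality.refl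
                 ; inv-r = λ _ → Relation.Binary.PropositionalEquality.refl
                 ; pres = λ _ _ a → a ; refl' = λ _ _ a → a }

  compAut : Aut m n k ℓ → Aut m n k ℓ → Aut m n k ℓ
  compAut g h = record
    { fun = fun g ∘ fun h ; inv = inv h ∘ inv g
    ; inv-l = λ u → Relation.Binary.PropositionalEquality.trans
                      (Relation.Binary.PropositionalEquality.cong (inv h) (inv-l g (fun h u))) (inv-l h u)
    ; inv-r = λ u → Relation.Binary.PropositionalEquality.trans
                      (Relation.Binary.PropositionalEquality.cong (fun g) (inv-r h (inv g u))) (inv-r g u)
    ; pres = λ u v a → pres g _ _ (pres h u v a)
    ; refl' = λ u v a → refl' h u v (refl' g _ _ a) }

  invAut : Aut m n k ℓ → Aut m n k ℓ
  invAut g = record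
    { fun = inv g ; inv = fun g ; inv-l = inv-r g ; inv-r = inv-l g
    ; pres = λ u v a → refl' g _ _ (Relation.Binary.PropositionalEquality.subst₂ (Adj m n k ℓ)
                          (Relation.Binary.PropositionalEquality.sym (inv-r g u))
                          (Relation.Binary.PropositionalEquality.sym (inv-r g v)) a)
    ; refl' = λ u v a → Relation.Binary.PropositionalEquality.subst₂ (Adj m n k ℓ)
                          (inv-r g u) (inv-r g v) (pres g _ _ a) }

  record IsSubgroup (G : Aut m n k ℓ → Set) : Set where
    field
      has-id   : G idAut
      has-comp : ∀ g h → G g → G h → G (compAut g h)
      has-inv  : ∀ g → G g → G (invAut g)

  VertexTransitive : (Aut m n k ℓ → Set) → Set
  VertexTransitive G = ∀ u v → Σ (Aut m n k ℓ) λ g → G g × fun g u ≡ v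

  -- G preserves the 2-factor C = {C_i}: each g ∈ G maps every cycle C_i
  -- (the cycle induced on V_i) onto some C_{i'}, i.e. maps V_i onto V_{i'}.
  PreservesC : (Aut m n k ℓ → Set) → Set
  PreservesC G = ∀ g → G g → ∀ (i : Fin m) → Σ (Fin m) λ i' →
    (∀ j → Data.Product.proj₁ (fun g (i , j)) ≡ i') ×
    (∀ j' → Σ (Fin n) λ j → fun g (i , j) ≡ (i' , j'))

module Submission where

-- Every vertex u_{i,j} has exactly one neighbour outside its cycle C_i, so an automorphism g
-- preserving 𝒞 maps these outer edges to outer edges; and since k_i is a unit, g maps C_i onto
-- some C_{L(i)} by an affine map with slope ±k_{L(i)} per step k_i. Choosing g with g(u_{0,0}) = v
-- and comparing the images of the rungs at u_{0,0} and u_{0,2k₁}, which are 2k₁ steps apart on C_0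
-- (k₀ = 1) but two steps apart on C_1, gives 2k₁k_b = ±2k_{b′} whenever v ∈ C_b has its outer
-- neighbour in C_{b′}. For v = u_{1,0}, u_{a,a} and u_{m-1,m-1} this yields 2k₁² = 2ε with ε = ±1,
-- 2k_a = ±2k₁^a and 2k₁k_{m-1} = ±2; hence 2k_a² = 2ε^a, and 2ε = 2 when m is odd.
-- If m is even and ε = -1, follow an automorphism with g(u_{0,0}) = u_{1,1} once around all layers
-- on two points x and -x: the unknown signs cancel, giving 2ℓ·(±k₁) = 2ℓ, which together with
-- 2k₁² = -2 forces 2ℓ = 0.

open import Defs
open import Data.Nat using (ℕ; _≤_; NonZero)
open import Data.Nat.DivMod using (_%_)
open import Data.Nat.Coprimality using (Coprime)
open import Data.Fin using (Fin; toℕ)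
open import Data.Product using (_×_)
open import Data.Sum using (_⊎_)
open import Relation.Binary.PropositionalEquality using (_≡_)
open import Relation.Nullary using (¬_)

open import Data.Nat.Base as ℕ using (zero; suc; _<_)
import Data.Nat.Properties as ℕ
import Data.Nat.Divisibility as ℕ
open import Data.Nat.DivMod using (_/_; m%n<n; m≡m%n+[m/n]*n; [m+kn]%n≡m%n; m<n⇒m%n≡m)
open import Data.Nat.Coprimality using (coprime-Bézout; coprime-divisor)
import Data.Nat.Coprimality as Coprime
open import Data.Nat.GCD using (module Bézout)
open import Data.Integer.Base as ℤ using (ℤ; +_; -[1+_]; _+_; _*_; -_; _-_; _^_; _◃_)
import Data.Integer.Properties as ℤ
open import Data.Integer.DivMod using (_%ℕ_; _/ℕ_; a≡a%ℕn+[a/ℕn]*n)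
open import Data.Integer.Divisibility.Signed
  using (_∣_; divides; ∣-trans; ∣ᵤ⇒∣; ∣m∣n⇒∣m+n; ∣m⇒∣-m; ∣n⇒∣m*n)
open import Data.Integer.Tactic.RingSolver using (solve-∀)
open import Data.Sign.Base as Sign using (Sign)
import Data.Sign.Properties as Sign
open import Data.Fin.Base using (fromℕ<)
open import Data.Fin.Properties using (toℕ-fromℕ<; toℕ-injective; fromℕ<-toℕ; toℕ<n)
open import Data.Product using (Σ; ∃; _,_; proj₁; proj₂)
import Data.Sum as Sum
open import Data.Sum using (inj₁; inj₂)
open import Data.Empty using (⊥; ⊥-elim)
open import Function using (_∘_)
open import Relation.Binary.PropositionalEquality
open import Relation.Binary.Bundles using (Setoid)

infix 4 _≡_mod_ _≡±_mod_

record _≡_mod_ (x y : ℤ) (n : ℕ) : Set where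
  constructor mod-intro
  field divides-difference : + n ∣ x - y
open _≡_mod_

module _ {n : ℕ} where

  private
    via : ∀ {a z w} → a ≡ z - w → + n ∣ a → z ≡ w mod n
    via e p = mod-intro (subst (+ n ∣_) e p)

  mod-reflexive : ∀ {x y} → x ≡ y → x ≡ y mod n
  mod-reflexive {x} refl = mod-intro (divides (+ 0) (ℤ.+-inverseʳ x))

  mod-refl : ∀ {x} → x ≡ x mod n
  mod-refl = mod-reflexive refl

  mod-sym : ∀ {x y} → x ≡ y mod n → y ≡ x mod n
  mod-sym {x} {y} = via (identity x y) ∘ ∣m⇒∣-m ∘ divides-difference
    where identity : ∀ x y → - (x + - y) ≡ y + - x
          identity = solve-∀

  mod-trans : ∀ {x y z} → x ≡ y mod n → y ≡ z mod n → x ≡ z mod n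
  mod-trans {x} {y} {z} (mod-intro p) (mod-intro q) = via (identity x y z) (∣m∣n⇒∣m+n p q)
    where identity : ∀ x y z → (x + - y) + (y + - z) ≡ x + - z
          identity = solve-∀

  mod-setoid : Setoid _ _
  mod-setoid = record
    { Carrier = ℤ ; _≈_ = _≡_mod n
    ; isEquivalence = record { refl = mod-refl ; sym = mod-sym ; trans = mod-trans } }

  +-cong : ∀ {x y x′ y′} → x ≡ y mod n → x′ ≡ y′ mod n → x + x′ ≡ y + y′ mod n
  +-cong {x} {y} {x′} {y′} (mod-intro p) (mod-intro q) = via (identity x y x′ y′) (∣m∣n⇒∣m+n p q)
    where identity : ∀ x y x′ y′ → (x + - y) + (x′ + - y′) ≡ (x + x′) + - (y + y′)
          identity = solve-∀

  *-cong : ∀ {x y x′ y′} → x ≡ y mod n → x′ ≡ y′ mod n → x * x′ ≡ y * y′ mod n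
  *-cong {x} {y} {x′} {y′} (mod-intro p) (mod-intro q) =
    via (identity x y x′ y′) (∣m∣n⇒∣m+n (∣n⇒∣m*n x′ p) (∣n⇒∣m*n y q))
    where identity : ∀ x y x′ y′ → x′ * (x + - y) + y * (x′ + - y′) ≡ x * x′ + - (y * y′)
          identity = solve-∀

  -‿cong : ∀ {x y} → x ≡ y mod n → - x ≡ - y mod n
  -‿cong {x} {y} = via (identity x y) ∘ ∣m⇒∣-m ∘ divides-difference
    where identity : ∀ x y → - (x + - y) ≡ - x + - (- y)
          identity = solve-∀

  +-congˡ : ∀ c {x y} → x ≡ y mod n → c + x ≡ c + y mod n
  +-congˡ c = +-cong (mod-refl {c})

  +-congʳ : ∀ c {x y} → x ≡ y mod n → x + c ≡ y + c mod n
  +-congʳ c p = +-cong p (mod-refl {c})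

  *-congˡ : ∀ c {x y} → x ≡ y mod n → c * x ≡ c * y mod n
  *-congˡ c = *-cong (mod-refl {c})

  *-congʳ : ∀ c {x y} → x ≡ y mod n → x * c ≡ y * c mod n
  *-congʳ c p = *-cong p (mod-refl {c})

  +-cancelˡ : ∀ c {x y} → c + x ≡ c + y mod n → x ≡ y mod n
  +-cancelˡ c {x} {y} (mod-intro p) = via (identity c x y) p
    where identity : ∀ c x y → (c + x) + - (c + y) ≡ x + - y
          identity = solve-∀

  +-cancelʳ : ∀ c {x y} → x + c ≡ y + c mod n → x ≡ y mod n
  +-cancelʳ c {x} {y} (mod-intro p) = via (identity c x y) p
    where identity : ∀ c x y → (x + c) + - (y + c) ≡ x + - y
          identity = solve-∀

  mod-weaken : ∀ {d x y} → d ℕ.∣ n → x ≡ y mod n → x ≡ y mod d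
  mod-weaken d∣n (mod-intro p) = mod-intro (∣-trans (∣ᵤ⇒∣ d∣n) p)

private
  i-j≡k⇒i≡j+k : ∀ i j k → i + - j ≡ k → i ≡ j + k
  i-j≡k⇒i≡j+k i j k e = trans (identity i j) (cong (λ x → j + x) e)
    where identity : ∀ i j → i ≡ j + (i + - j)
          identity = solve-∀

  i≡j+k⇒i-j≡k : ∀ {i j k} → i ≡ j + k → i + - j ≡ k
  i≡j+k⇒i-j≡k {j = j} {k} e = trans (cong (λ x → x + - j) e) (identity j k)
    where identity : ∀ j k → j + k + - j ≡ k
          identity = solve-∀

ι : ∀ {n} → Fin n → ℤ
ι a = + toℕ a

module _ {n : ℕ} {{_ : NonZero n}} where

  ≡%-mod : ∀ a → + a ≡ + (a % n) mod n
  ≡%-mod a = mod-intro (divides (+ (a / n)) (i≡j+k⇒i-j≡k {j = + (a % n)} (begin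
      + a                              ≡⟨ cong +_ (m≡m%n+[m/n]*n a n) ⟩
      + (a % n ℕ.+ a / n ℕ.* n)        ≡⟨ ℤ.pos-+ (a % n) (a / n ℕ.* n) ⟩
      + (a % n) + + (a / n ℕ.* n)      ≡⟨ cong (λ x → + (a % n) + x) (ℤ.pos-* (a / n) n) ⟩
      + (a % n) + + (a / n) * + n      ∎)))
    where open ≡-Reasoning

  %⇒mod : ∀ {a b} → a % n ≡ b % n → + a ≡ + b mod n
  %⇒mod {a} {b} e = mod-trans (≡%-mod a) (mod-trans (mod-reflexive (cong +_ e)) (mod-sym (≡%-mod b)))

  mod⇒% : ∀ {a b} → + a ≡ + b mod n → a % n ≡ b % n
  mod⇒% {a} {b} (mod-intro (divides (+ r) e)) = begin
      a % n               ≡⟨ cong (_% n) (ℤ.+-injective (trans (i-j≡k⇒i≡j+k (+ a) (+ b) _ e) b+rn)) ⟩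
      (b ℕ.+ r ℕ.* n) % n ≡⟨ [m+kn]%n≡m%n b r n ⟩
      b % n               ∎
    where open ≡-Reasoning
          b+rn : + b + + r * + n ≡ + (b ℕ.+ r ℕ.* n)
          b+rn = sym (trans (ℤ.pos-+ b (r ℕ.* n)) (cong (λ x → + b + x) (ℤ.pos-* r n)))
  mod⇒% {a} {b} (mod-intro (divides -[1+ r ] e)) = sym (mod⇒% (mod-intro (divides (+ suc r) e′)))
    where e′ : + b - + a ≡ + suc r * + n
          e′ = begin
            + b - + a              ≡⟨ identity (+ a) (+ b) ⟩
            - (+ a - + b)          ≡⟨ cong -_ e ⟩
            - (-[1+ r ] * + n)     ≡⟨ ℤ.neg-distribˡ-* -[1+ r ] (+ n) ⟩
            + suc r * + n          ∎
            where open ≡-Reasoning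
                  identity : ∀ a b → b + - a ≡ - (a + - b)
                  identity = solve-∀

  mod-0⇒∣ : ∀ {a} → + a ≡ + 0 mod n → n ℕ.∣ a
  mod-0⇒∣ {a} e = ℕ.m%n≡0⇒n∣m a n (trans (mod⇒% e) (ℕ.n∣m⇒m%n≡0 0 n (ℕ._∣0 n)))

  ι-toZ : ∀ a → ι (toZ {n} a) ≡ + a mod n
  ι-toZ a = mod-trans (mod-reflexive (cong +_ (toℕ-fromℕ< _))) (mod-sym (≡%-mod a))

  ι-⊕ : ∀ a b → ι (a ⊕ b) ≡ ι a + ι b mod n
  ι-⊕ a b = mod-trans (ι-toZ (toℕ a ℕ.+ toℕ b)) (mod-reflexive (ℤ.pos-+ (toℕ a) (toℕ b)))

  ι-⊗ : ∀ a b → ι (a ⊗ b) ≡ ι a * ι b mod n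
  ι-⊗ a b = mod-trans (ι-toZ (toℕ a ℕ.* toℕ b)) (mod-reflexive (ℤ.pos-* (toℕ a) (toℕ b)))

  ι-⊖ : ∀ a → ι (⊖ a) ≡ - ι a mod n
  ι-⊖ a = mod-trans (ι-toZ (n ℕ.∸ toℕ a))
    (mod-trans (mod-reflexive n-a) (mod-trans (+-congʳ (- ι a) n≡0) (mod-reflexive (ℤ.+-identityˡ (- ι a)))))
    where n-a : + (n ℕ.∸ toℕ a) ≡ + n + - ι a
          n-a = sym (trans (ℤ.m-n≡m⊖n n (toℕ a)) (ℤ.⊖-≥ (ℕ.<⇒≤ (toℕ<n a))))
          n≡0 : + n ≡ + 0 mod n
          n≡0 = mod-intro (divides (+ 1) (trans (ℤ.+-identityʳ (+ n)) (sym (ℤ.*-identityˡ (+ n)))))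

  ι-injective : ∀ {a b} → ι a ≡ ι b mod n → a ≡ b
  ι-injective {a} {b} e = toℕ-injective (begin
      toℕ a     ≡⟨ m<n⇒m%n≡m (toℕ<n a) ⟨
      toℕ a % n ≡⟨ mod⇒% e ⟩
      toℕ b % n ≡⟨ m<n⇒m%n≡m (toℕ<n b) ⟩
      toℕ b     ∎)
    where open ≡-Reasoning

  ⊕-cancelʳ : ∀ {x y w : Fin n} → x ⊕ w ≡ y ⊕ w → x ≡ y
  ⊕-cancelʳ {x} {y} {w} e = ι-injective (+-cancelʳ (ι w)
    (mod-trans (mod-sym (ι-⊕ x w)) (mod-trans (mod-reflexive (cong ι e)) (ι-⊕ y w))))

  ⊕-identityʳ : ∀ (x : Fin n) → x ⊕ toZ 0 ≡ x
  ⊕-identityʳ x = ι-injective (mod-trans (ι-⊕ x (toZ 0))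
    (mod-trans (+-congˡ (ι x) (ι-toZ 0)) (mod-reflexive (ℤ.+-identityʳ (ι x)))))

  ℤ-residue : ∀ c → ∃ λ t → c ≡ + t mod n
  ℤ-residue c = c %ℕ n , mod-intro (divides (c /ℕ n) (i≡j+k⇒i-j≡k (a≡a%ℕn+[a/ℕn]*n c n)))

  Coprime⇒invertible : ∀ {κ} → Coprime κ n → ∃ λ u → u * + κ ≡ + 1 mod n
  Coprime⇒invertible {κ} c with coprime-Bézout c
  ... | Bézout.+- x y eq = + x , mod-intro (divides (+ y) (i≡j+k⇒i-j≡k (begin
      + x * + κ           ≡⟨ ℤ.pos-* x κ ⟨
      + (x ℕ.* κ)         ≡⟨ cong +_ eq ⟨
      + (1 ℕ.+ y ℕ.* n)   ≡⟨ ℤ.pos-+ 1 (y ℕ.* n) ⟩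
      + 1 + + (y ℕ.* n)   ≡⟨ cong (λ z → + 1 + z) (ℤ.pos-* y n) ⟩
      + 1 + + y * + n     ∎)))
    where open ≡-Reasoning
  ... | Bézout.-+ x y eq = - + x , mod-intro (divides (- + y) (begin
      - + x * + κ + - + 1     ≡⟨ identity (+ x) (+ κ) ⟩
      - (+ 1 + + x * + κ)     ≡⟨ cong (λ z → - (+ 1 + z)) (ℤ.pos-* x κ) ⟨
      - (+ 1 + + (x ℕ.* κ))   ≡⟨ cong -_ (ℤ.pos-+ 1 (x ℕ.* κ)) ⟨
      - + (1 ℕ.+ x ℕ.* κ)     ≡⟨ cong (λ z → - + z) eq ⟩
      - + (y ℕ.* n)           ≡⟨ cong -_ (ℤ.pos-* y n) ⟩
      - (+ y * + n)           ≡⟨ ℤ.neg-distribˡ-* (+ y) (+ n) ⟩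
      - + y * + n             ∎))
    where open ≡-Reasoning
          identity : ∀ x κ → - x * κ + - + 1 ≡ - (+ 1 + x * κ)
          identity = solve-∀

  Coprime⇒double≢0 : ∀ {κ} → 2 < n → Coprime κ n → ¬ (+ 2 * + κ ≡ + 0 mod n)
  Coprime⇒double≢0 {κ} 2<n c e = ℕ.<⇒≱ 2<n (ℕ.∣⇒≤ (coprime-divisor (Coprime.sym c) n∣κ*2))
    where n∣κ*2 : n ℕ.∣ κ ℕ.* 2
          n∣κ*2 = subst (n ℕ.∣_) (ℕ.*-comm 2 κ) (mod-0⇒∣ (mod-trans (mod-reflexive (ℤ.pos-* 2 κ)) e))

%2-split : ∀ a → a % 2 ≡ 0 ⊎ a % 2 ≡ 1
%2-split a with a % 2 | m%n<n a 2
... | 0           | _                   = inj₁ refl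
... | 1           | _                   = inj₂ refl
... | suc (suc _) | ℕ.s≤s (ℕ.s≤s ())

parity-decomposition : ∀ a → + a ≡ + (a % 2) + + 2 * + (a / 2)
parity-decomposition a = trans (cong +_ (m≡m%n+[m/n]*n a 2)) (trans (ℤ.pos-+ (a % 2) (a / 2 ℕ.* 2))
  (cong (λ z → + (a % 2) + z) (trans (ℤ.pos-* (a / 2) 2) (ℤ.*-comm (+ (a / 2)) (+ 2)))))

1≢0-mod-2 : ¬ (+ 1 ≡ + 0 mod 2)
1≢0-mod-2 e with mod⇒% e
... | ()

suc≢-mod-2 : ∀ t → ¬ (+ suc t ≡ + t mod 2)
suc≢-mod-2 t e = 1≢0-mod-2 (+-cancelʳ (+ t) e)

double≡0-mod-2 : ∀ a → + 2 * a ≡ + 0 mod 2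
double≡0-mod-2 a = mod-intro (divides a (identity a))
  where identity : ∀ a → + 2 * a + - + 0 ≡ a * + 2
        identity = solve-∀

Coprime⇒odd : ∀ {κ n} → 2 ℕ.∣ n → Coprime κ n → + κ ≡ + 1 mod 2
Coprime⇒odd {κ} 2∣n c with %2-split κ
... | inj₂ κ%2≡1 = %⇒mod κ%2≡1
... | inj₁ κ%2≡0 with c (ℕ.m%n≡0⇒n∣m κ 2 κ%2≡0 , 2∣n)
... | ()

unit : Sign → ℤ
unit s = s ◃ 1

unit-* : ∀ s t → unit s * unit t ≡ unit (s Sign.* t)
unit-* s t = sym (ℤ.◃-distrib-* s t 1 1)

unit-square : ∀ s → unit s * unit s ≡ + 1
unit-square s = trans (unit-* s s) (cong unit (Sign.s*s≡+ s))

unit-^ : ∀ s q → ∃ λ t → unit s ^ q ≡ unit t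
unit-^ s zero    = Sign.+ , refl
unit-^ s (suc q) with unit-^ s q
... | t , e = s Sign.* t , trans (cong (unit s *_) e) (unit-* s t)

unit-odd : ∀ s → unit s ≡ + 1 mod 2
unit-odd Sign.+ = mod-refl
unit-odd Sign.- = mod-intro (divides (- + 1) refl)

double-unit-cases : ∀ s → + 2 * unit s ≡ + 2 ⊎ + 2 * unit s ≡ - + 2
double-unit-cases Sign.+ = inj₁ refl
double-unit-cases Sign.- = inj₂ refl

record _≡±_mod_ (x y : ℤ) (n : ℕ) : Set where
  constructor _,_
  field
    sign       : Sign
    congruence : x ≡ unit sign * y mod n

module _ {n : ℕ} where

  private
    then-≡ : ∀ {x y z} → x ≡ y mod n → y ≡ z → x ≡ z mod n
    then-≡ p e = mod-trans p (mod-reflexive e)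

  mod⇒± : ∀ {x y} → x ≡ y mod n → x ≡± y mod n
  mod⇒± {y = y} e = Sign.+ , then-≡ e (sym (ℤ.*-identityˡ y))

  ±⇒⊎ : ∀ {x y} → x ≡± y mod n → x ≡ y mod n ⊎ x ≡ - y mod n
  ±⇒⊎ {y = y} (Sign.+ , c) = inj₁ (then-≡ c (ℤ.*-identityˡ y))
  ±⇒⊎ {y = y} (Sign.- , c) = inj₂ (then-≡ c (ℤ.-1*i≡-i y))

  ±-sym : ∀ {x y} → x ≡± y mod n → y ≡± x mod n
  ±-sym {x} {y} (s , e) = s , mod-sym (then-≡ (*-congˡ (unit s) e) (begin
      unit s * (unit s * y) ≡⟨ ℤ.*-assoc (unit s) (unit s) y ⟨
      unit s * unit s * y   ≡⟨ cong (_* y) (unit-square s) ⟩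
      + 1 * y               ≡⟨ ℤ.*-identityˡ y ⟩
      y                     ∎))
    where open ≡-Reasoning

  ±-trans : ∀ {x y z} → x ≡± y mod n → y ≡± z mod n → x ≡± z mod n
  ±-trans {z = z} (s , e) (t , f) = s Sign.* t , mod-trans e (then-≡ (*-congˡ (unit s) f)
      (trans (sym (ℤ.*-assoc (unit s) (unit t) z)) (cong (_* z) (unit-* s t))))

  ±-*-congˡ : ∀ (c : ℤ) {x y} → x ≡± y mod n → c * x ≡± c * y mod n
  ±-*-congˡ c {y = y} (s , e) = s , then-≡ (*-congˡ c e) (identity c (unit s) y)
    where identity : ∀ c u y → c * (u * y) ≡ u * (c * y)
          identity = solve-∀

  double-unit-^ : ∀ s q → + 2 * unit s ^ q ≡± + 2 mod n
  double-unit-^ s q with unit-^ s q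
  ... | t , e = t , mod-reflexive (trans (cong (λ u → + 2 * u) e) (ℤ.*-comm (+ 2) (unit t)))

  ±-square : ∀ {x y} → + 2 * x ≡± + 2 * y mod n → + 2 * (x * x) ≡ + 2 * (y * y) mod n
  ±-square {x} {y} (s , e) = begin
      + 2 * (x * x)               ≡⟨ identity₁ x ⟩
      x * (+ 2 * x)               ≈⟨ *-congˡ x e ⟩
      x * (u * (+ 2 * y))         ≡⟨ identity₂ x u y ⟩
      (u * y) * (+ 2 * x)         ≈⟨ *-congˡ (u * y) e ⟩
      (u * y) * (u * (+ 2 * y))   ≡⟨ identity₃ u y ⟩
      (u * u) * (+ 2 * (y * y))   ≡⟨ cong (_* (+ 2 * (y * y))) (unit-square s) ⟩
      + 1 * (+ 2 * (y * y))       ≡⟨ ℤ.*-identityˡ _ ⟩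
      + 2 * (y * y)               ∎
    where
      open import Relation.Binary.Reasoning.Setoid (mod-setoid {n})
      u : ℤ
      u = unit s
      identity₁ : ∀ x → + 2 * (x * x) ≡ x * (+ 2 * x)
      identity₁ = solve-∀
      identity₂ : ∀ x u y → x * (u * (+ 2 * y)) ≡ (u * y) * (+ 2 * x)
      identity₂ = solve-∀
      identity₃ : ∀ u y → (u * y) * (u * (+ 2 * y)) ≡ (u * u) * (+ 2 * (y * y))
      identity₃ = solve-∀

  double-square-^ : ∀ {x y} → + 2 * (x * x) ≡ + 2 * y mod n →
                    ∀ q → + 2 * (x ^ q * x ^ q) ≡ + 2 * y ^ q mod n
  double-square-^ e zero = mod-refl
  double-square-^ {x} {y} e (suc q) = begin
      + 2 * ((x * a) * (x * a))   ≡⟨ identity₁ x a ⟩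
      (+ 2 * (x * x)) * (a * a)   ≈⟨ *-congʳ (a * a) e ⟩
      (+ 2 * y) * (a * a)         ≡⟨ identity₂ y a ⟩
      y * (+ 2 * (a * a))         ≈⟨ *-congˡ y (double-square-^ e q) ⟩
      y * (+ 2 * y ^ q)           ≡⟨ identity₃ y (y ^ q) ⟩
      + 2 * (y * y ^ q)           ∎
    where
      open import Relation.Binary.Reasoning.Setoid (mod-setoid {n})
      a : ℤ
      a = x ^ q
      identity₁ : ∀ x a → + 2 * ((x * a) * (x * a)) ≡ (+ 2 * (x * x)) * (a * a)
      identity₁ = solve-∀
      identity₂ : ∀ y a → (+ 2 * y) * (a * a) ≡ y * (+ 2 * (a * a))
      identity₂ = solve-∀
      identity₃ : ∀ y b → y * (+ 2 * b) ≡ + 2 * (y * b)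
      identity₃ = solve-∀

  double-fixed-^ : ∀ {y} → + 2 * y ≡ + 2 mod n → ∀ q → + 2 * y ^ q ≡ + 2 mod n
  double-fixed-^ e zero = mod-refl
  double-fixed-^ {y} e (suc q) = begin
      + 2 * (y * y ^ q)   ≡⟨ identity y (y ^ q) ⟩
      y * (+ 2 * y ^ q)   ≈⟨ *-congˡ y (double-fixed-^ e q) ⟩
      y * + 2             ≡⟨ ℤ.*-comm y (+ 2) ⟩
      + 2 * y             ≈⟨ e ⟩
      + 2                 ∎
    where
      open import Relation.Binary.Reasoning.Setoid (mod-setoid {n})
      identity : ∀ y a → + 2 * (y * a) ≡ y * (+ 2 * a)
      identity = solve-∀

private
  cofactor : Sign → ℤ → ℤ
  cofactor Sign.+ w = w + + 1
  cofactor Sign.- w = - w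

  -- For κ = 1 + 2w: r(2κ² + 2) = 4r + 8rw(w + 1), and the cofactor turns 4r(±κ - 1) into 8rw(w + 1) too.
  four-r-identity : ∀ ρ r w →
    + 2 * (+ 2 * r) ≡
    r * (+ 2 * ((+ 1 + + 2 * w) * (+ 1 + + 2 * w)) + + 2)
      + - (cofactor ρ w * (+ 2 * (+ 2 * r) * (unit ρ * (+ 1 + + 2 * w)) + - (+ 2 * (+ 2 * r))))
  four-r-identity Sign.+ = identity
    where identity : ∀ r w → + 2 * (+ 2 * r) ≡
            r * (+ 2 * ((+ 1 + + 2 * w) * (+ 1 + + 2 * w)) + + 2)
              + - ((w + + 1) * (+ 2 * (+ 2 * r) * (+ 1 * (+ 1 + + 2 * w)) + - (+ 2 * (+ 2 * r))))
          identity = solve-∀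
  four-r-identity Sign.- = identity
    where identity : ∀ r w → + 2 * (+ 2 * r) ≡
            r * (+ 2 * ((+ 1 + + 2 * w) * (+ 1 + + 2 * w)) + + 2)
              + - (- w * (+ 2 * (+ 2 * r) * (- + 1 * (+ 1 + + 2 * w)) + - (+ 2 * (+ 2 * r))))
          identity = solve-∀

double-fixed-by-±odd⇒≡0 : ∀ {n x κ} ρ r w → x ≡ + 2 * r → κ ≡ + 1 + + 2 * w →
  + 2 * (κ * κ) ≡ - + 2 mod n → + 2 * x * (unit ρ * κ) ≡ + 2 * x mod n → + 2 * x ≡ + 0 mod n
double-fixed-by-±odd⇒≡0 {n} ρ r w refl refl κ²≡-1 fixed = begin
    + 2 * (+ 2 * r)                                        ≡⟨ four-r-identity ρ r w ⟩
    r * (+ 2 * (κ * κ) + + 2) + - (c * (+ 2 * x * (unit ρ * κ) + - (+ 2 * x)))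
      ≈⟨ +-cong (*-congˡ r (+-congʳ (+ 2) κ²≡-1)) (-‿cong (*-congˡ c (+-congʳ (- (+ 2 * x)) fixed))) ⟩
    r * (- + 2 + + 2) + - (c * (+ 2 * x + - (+ 2 * x)))    ≡⟨ identity r c (+ 2 * x) ⟩
    + 0                                                    ∎
  where
    open import Relation.Binary.Reasoning.Setoid (mod-setoid {n})
    κ x c : ℤ
    κ = + 1 + + 2 * w
    x = + 2 * r
    c = cofactor ρ w
    identity : ∀ r c y → r * (- + 2 + + 2) + - (c * (y + - y)) ≡ + 0
    identity = solve-∀

module _ {n : ℕ} {{_ : NonZero n}} where

  ι-double : ∀ a → ι (toZ 2 ⊗ a) ≡ + 2 * ι a mod n
  ι-double a = mod-trans (ι-⊗ (toZ 2) a) (*-congʳ (ι a) (ι-toZ 2))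

  double≡⇒ : ∀ {a b c} → + 2 * ι a ≡ c mod n → ι b ≡ c mod n → toZ 2 ⊗ a ≡ b
  double≡⇒ {a} e₁ e₂ = ι-injective (mod-trans (ι-double a) (mod-trans e₁ (mod-sym e₂)))

  ι-⊖2 : ι (⊖ toZ {n} 2) ≡ - + 2 mod n
  ι-⊖2 = mod-trans (ι-⊖ (toZ 2)) (-‿cong (ι-toZ 2))

module Graph (m n : ℕ) {{_ : NonZero n}} (k : Fin m → Fin n) (ℓ : Fin n)
             (3≤m : 3 ≤ m) (2∣n : 2 ℕ.∣ n) (ℓ≡m : ι ℓ ≡ + m mod 2) where

  Γ : Vertex m n → Vertex m n → Set
  Γ = Adj m n k ℓ

  data ArcShape (i : Fin m) (x : Fin n) (i′ : Fin m) (z : Fin n) : Set where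
    cycle-arc : i ≡ i′ → z ≡ x ⊕ k i → ArcShape i x i′ z
    rung-arc  : toℕ i′ ≡ suc (toℕ i) → z ≡ x → toℕ x % 2 ≡ toℕ i % 2 → ArcShape i x i′ z
    wrap-arc  : suc (toℕ i) ≡ m → toℕ i′ ≡ 0 → z ≡ x ⊕ ℓ → toℕ x % 2 ≡ toℕ i % 2 → ArcShape i x i′ z

  arc-shape : ∀ {u v} → Arc m n k ℓ u v → ArcShape (proj₁ u) (proj₂ u) (proj₁ v) (proj₂ v)
  arc-shape (cyc i j)            = cycle-arc refl refl
  arc-shape (rung i j p q)       = rung-arc (toℕ-fromℕ< p) refl q
  arc-shape (wrap i i₀ j e e₀ q) = wrap-arc e e₀ refl q

  data OuterArc (i : Fin m) (x : Fin n) : Fin m → Fin n → Set where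
    up     : ∀ {i′} → toℕ i′ ≡ suc (toℕ i) → ι x ≡ ι i mod 2 → OuterArc i x i′ x
    down   : ∀ {i′} → toℕ i ≡ suc (toℕ i′) → ι x ≡ ι i′ mod 2 → OuterArc i x i′ x
    wrap   : ∀ {i′} → suc (toℕ i) ≡ m → toℕ i′ ≡ 0 → ι x ≡ ι i mod 2 → OuterArc i x i′ (x ⊕ ℓ)
    unwrap : ∀ {i′ z} → suc (toℕ i′) ≡ m → toℕ i ≡ 0 → ι z ≡ ι i′ mod 2 → x ≡ z ⊕ ℓ →
             OuterArc i x i′ z

  m≢1 : m ≢ 1
  m≢1 refl = ℕ.<⇒≱ 3≤m (ℕ.s≤s ℕ.z≤n)

  inner-arc : ∀ {i x z} → Γ (i , x) (i , z) → z ≡ x ⊕ k i ⊎ x ≡ z ⊕ k i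
  inner-arc (inj₁ a) with arc-shape a
  ... | cycle-arc _ e     = inj₁ e
  ... | rung-arc e _ _    = ⊥-elim (ℕ.1+n≢n (sym e))
  ... | wrap-arc e e₀ _ _ = ⊥-elim (m≢1 (trans (sym e) (cong suc e₀)))
  inner-arc (inj₂ a) with arc-shape a
  ... | cycle-arc _ e     = inj₂ e
  ... | rung-arc e _ _    = ⊥-elim (ℕ.1+n≢n (sym e))
  ... | wrap-arc e e₀ _ _ = ⊥-elim (m≢1 (trans (sym e) (cong suc e₀)))

  outer-arc : ∀ {i x i′ z} → Γ (i , x) (i′ , z) → i ≢ i′ → OuterArc i x i′ z
  outer-arc (inj₁ a) i≢i′ with arc-shape a
  ... | cycle-arc e _         = ⊥-elim (i≢i′ e)
  ... | rung-arc e refl q     = up e (%⇒mod q)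
  ... | wrap-arc e e₀ refl q  = wrap e e₀ (%⇒mod q)
  outer-arc (inj₂ a) i≢i′ with arc-shape a
  ... | cycle-arc e _         = ⊥-elim (i≢i′ (sym e))
  ... | rung-arc e refl q     = down e (%⇒mod q)
  ... | wrap-arc e e₀ x≡ q    = unwrap e e₀ (%⇒mod q) x≡

  private
    rung-to : ∀ {i i′ : Fin m} {x : Fin n} → toℕ i′ ≡ suc (toℕ i) → ι x ≡ ι i mod 2 →
              Arc m n k ℓ (i , x) (i′ , x)
    rung-to {i} {i′} {x} e q = subst (λ j → Arc m n k ℓ (i , x) (j , x))
      (toℕ-injective (trans (toℕ-fromℕ< p) (sym e))) (rung i x p (mod⇒% q))
      where p : suc (toℕ i) < m
            p = subst (_< m) e (toℕ<n i′)

  outer-arc⇒Γ : ∀ {i x i′ z} → OuterArc i x i′ z → Γ (i , x) (i′ , z)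
  outer-arc⇒Γ (up e q)                          = inj₁ (rung-to e q)
  outer-arc⇒Γ (down e q)                        = inj₂ (rung-to e q)
  outer-arc⇒Γ {i} {x} (wrap {i′} e e₀ q)        = inj₁ (wrap i i′ x e e₀ (mod⇒% q))
  outer-arc⇒Γ {i} (unwrap {i′} {z} e e₀ q refl) = inj₂ (wrap i′ i z e e₀ (mod⇒% q))

  private
    parity-clash : ∀ {a b : Fin m} {x : Fin n} → toℕ a ≡ suc (toℕ b) →
                   ι x ≡ ι a mod 2 → ι x ≡ ι b mod 2 → ⊥
    parity-clash {b = b} e xa xb =
      suc≢-mod-2 (toℕ b) (mod-trans (mod-reflexive (cong +_ (sym e))) (mod-trans (mod-sym xa) xb))

    wrapped-odd : ∀ {i′ : Fin m} {z : Fin n} → suc (toℕ i′) ≡ m → ι z ≡ ι i′ mod 2 → ι (z ⊕ ℓ) ≡ + 1 mod 2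
    wrapped-odd {i′} {z} e q = mod-trans (mod-weaken 2∣n (ι-⊕ z ℓ))
      (mod-trans (+-cong q (mod-trans ℓ≡m (mod-reflexive (cong +_ (sym e)))))
        (mod-intro (divides (+ toℕ i′) (identity (+ toℕ i′)))))
      where identity : ∀ t → t + (+ 1 + t) + - + 1 ≡ t * + 2
            identity = solve-∀

    up-unwrap-clash : ∀ {i i′ : Fin m} {x z : Fin n} → toℕ i ≡ 0 → ι x ≡ ι i mod 2 →
                      suc (toℕ i′) ≡ m → ι z ≡ ι i′ mod 2 → x ≡ z ⊕ ℓ → ⊥
    up-unwrap-clash e₀ xi e zi refl = 1≢0-mod-2
      (mod-trans (mod-sym (wrapped-odd e zi)) (mod-trans xi (mod-reflexive (cong +_ e₀))))

  outer-arc-unique : ∀ {i x i₁ z₁ i₂ z₂} → OuterArc i x i₁ z₁ → OuterArc i x i₂ z₂ →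
                     _≡_ {A = Vertex m n} (i₁ , z₁) (i₂ , z₂)
  outer-arc-unique (up e _)            (up e′ _)             = cong (_, _) (toℕ-injective (trans e (sym e′)))
  outer-arc-unique (up _ q)            (down e′ q′)          = ⊥-elim (parity-clash e′ q q′)
  outer-arc-unique {i₁ = i₁} (up e _)  (wrap e′ _ _)         = ⊥-elim (ℕ.<⇒≢ (toℕ<n i₁) (trans e e′))
  outer-arc-unique (up _ q)            (unwrap e′ e₀ q′ x≡)  = ⊥-elim (up-unwrap-clash e₀ q e′ q′ x≡)
  outer-arc-unique (down e q)          (up _ q′)             = ⊥-elim (parity-clash e q′ q)
  outer-arc-unique (down e _)          (down e′ _)           = cong (_, _) (toℕ-injective (ℕ.suc-injective (trans (sym e) e′)))
  outer-arc-unique (down e q)          (wrap _ _ q′)         = ⊥-elim (parity-clash e q′ q)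
  outer-arc-unique (down e _)          (unwrap _ e₀ _ _)     = ⊥-elim (ℕ.0≢1+n (trans (sym e₀) e))
  outer-arc-unique {i₂ = i₂} (wrap e _ _) (up e′ _)          = ⊥-elim (ℕ.<⇒≢ (toℕ<n i₂) (trans e′ e))
  outer-arc-unique (wrap _ _ q)        (down e′ q′)          = ⊥-elim (parity-clash e′ q q′)
  outer-arc-unique (wrap _ e₀ _)       (wrap _ e₀′ _)        = cong (_, _) (toℕ-injective (trans e₀ (sym e₀′)))
  outer-arc-unique (wrap e _ _)        (unwrap _ e₀ _ _)     = ⊥-elim (m≢1 (trans (sym e) (cong suc e₀)))
  outer-arc-unique (unwrap e e₀ q x≡)  (up _ q′)             = ⊥-elim (up-unwrap-clash e₀ q′ e q x≡)
  outer-arc-unique (unwrap _ e₀ _ _)   (down e′ _)           = ⊥-elim (ℕ.0≢1+n (trans (sym e₀) e′))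
  outer-arc-unique (unwrap _ e₀ _ _)   (wrap e′ _ _)         = ⊥-elim (m≢1 (trans (sym e′) (cong suc e₀)))
  outer-arc-unique (unwrap e _ _ x≡)   (unwrap e′ _ _ x≡′)   =
    cong₂ _,_ (toℕ-injective (ℕ.suc-injective (trans e (sym e′)))) (⊕-cancelʳ (trans (sym x≡) x≡′))

  outer-arc-irreflexive : ∀ {i x i′ z} → OuterArc i x i′ z → i ≢ i′
  outer-arc-irreflexive (up e _)          refl = ℕ.1+n≢n (sym e)
  outer-arc-irreflexive (down e _)        refl = ℕ.1+n≢n (sym e)
  outer-arc-irreflexive (wrap e e₀ _)     refl = m≢1 (trans (sym e) (cong suc e₀))
  outer-arc-irreflexive (unwrap e e₀ _ _) refl = m≢1 (trans (sym e) (cong suc e₀))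

MapsLayersOntoLayers : ∀ {m n} {{_ : NonZero n}} {k : Fin m → Fin n} {ℓ : Fin n} → Aut m n k ℓ → Set
MapsLayersOntoLayers {m} {n} g = ∀ (i : Fin m) → Σ (Fin m) λ i′ →
  (∀ j → proj₁ (fun g (i , j)) ≡ i′) × (∀ j′ → Σ (Fin n) λ j → fun g (i , j) ≡ (i′ , j′))

module LayerAutomorphism (m n : ℕ) {{_ : NonZero n}} (k : Fin m → Fin n) (ℓ : Fin n)
    (3≤m : 3 ≤ m) (2∣n : 2 ℕ.∣ n) (ℓ≡m : ι ℓ ≡ + m mod 2) (2<n : 2 < n)
    (coprime : ∀ i → Coprime (toℕ (k i)) n)
    (g : Aut m n k ℓ) (layers : MapsLayersOntoLayers g) where

  open Graph m n k ℓ 3≤m 2∣n ℓ≡m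

  L : Fin m → Fin m
  L i = proj₁ (layers i)

  T : Fin m → Fin n → Fin n
  T i x = proj₂ (fun g (i , x))

  g-on-layer : ∀ i x → fun g (i , x) ≡ (L i , T i x)
  g-on-layer i x = cong (_, T i x) (proj₁ (proj₂ (layers i)) x)

  g-split : ∀ {i x j y} → fun g (i , x) ≡ (j , y) → L i ≡ j × T i x ≡ y
  g-split {i} {x} {j} {y} e = cong proj₁ e′ , cong proj₂ e′
    where e′ : (L i , T i x) ≡ (j , y)
          e′ = trans (sym (g-on-layer i x)) e

  g-injective : ∀ {u v} → fun g u ≡ fun g v → u ≡ v
  g-injective {u} {v} e = trans (sym (inv-l g u)) (trans (cong (inv g) e) (inv-l g v))

  T-injective : ∀ i {x y} → T i x ≡ T i y → x ≡ y
  T-injective i {x} {y} e =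
    cong proj₂ (g-injective (trans (g-on-layer i x) (trans (cong (L i ,_) e) (sym (g-on-layer i y)))))

  L-injective : ∀ {i i′} → L i ≡ L i′ → i ≡ i′
  L-injective {i} {i′} e with proj₂ (proj₂ (layers i′)) (T i ℓ)
  ... | j , e′ = cong proj₁ (g-injective (trans (g-on-layer i ℓ) (trans (cong (_, T i ℓ) e) (sym e′))))

  g-preserves : ∀ {i x i′ z} → Γ (i , x) (i′ , z) → Γ (L i , T i x) (L i′ , T i′ z)
  g-preserves {i} {x} {i′} {z} a = subst₂ Γ (g-on-layer i x) (g-on-layer i′ z) (pres g _ _ a)

  outer-transport : ∀ {i x i′ x′ j y j′ y′} → fun g (i , x) ≡ (j , y) →
                    OuterArc i x i′ x′ → OuterArc j y j′ y′ → fun g (i′ , x′) ≡ (j′ , y′)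
  outer-transport {i} {x} {i′} {x′} e a b with g-split e
  ... | refl , refl = trans (g-on-layer i′ x′)
      (outer-arc-unique (outer-arc (g-preserves (outer-arc⇒Γ a)) (outer-arc-irreflexive a ∘ L-injective)) b)

  module _ (i : Fin m) where

    private
      κ κ′ : Fin n
      κ  = k i
      κ′ = k (L i)

    iterate : ℕ → Fin n → Fin n
    iterate zero    x = x
    iterate (suc t) x = iterate t x ⊕ κ

    ι-iterate : ∀ t x → ι (iterate t x) ≡ ι x + + t * ι κ mod n
    ι-iterate zero    x = mod-reflexive (identity (ι x) (ι κ))
      where identity : ∀ a b → a ≡ a + + 0 * b
            identity = solve-∀
    ι-iterate (suc t) x = mod-trans (ι-⊕ (iterate t x) κ)
      (mod-trans (+-congʳ (ι κ) (ι-iterate t x)) (mod-reflexive (identity (ι x) (+ t) (ι κ))))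
      where identity : ∀ a t b → a + t * b + b ≡ a + (+ 1 + t) * b
            identity = solve-∀

    iterate-hits : ∀ t c {x y} → c ≡ + t mod n → ι y ≡ ι x + c * ι κ mod n → iterate t x ≡ y
    iterate-hits t c {x} c≡t y≡ = ι-injective (mod-trans (ι-iterate t x)
      (mod-trans (+-congˡ (ι x) (*-congʳ (ι κ) (mod-sym c≡t))) (mod-sym y≡)))

    iterate-reaches : ∀ x y → ∃ λ t → iterate t x ≡ y
    iterate-reaches x y with Coprime⇒invertible (coprime i)
    ... | u , uκ≡1 with ℤ-residue ((ι y - ι x) * u)
    ... | t , c≡t = t , iterate-hits t _ c≡t (begin
        ι y                                    ≡⟨ identity (ι y) (ι x) ⟩
        ι x + (ι y - ι x) * + 1                ≈⟨ +-congˡ (ι x) (*-congˡ (ι y - ι x) (mod-sym uκ≡1)) ⟩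
        ι x + (ι y - ι x) * (u * ι κ)          ≡⟨ cong (λ z → ι x + z) (sym (ℤ.*-assoc (ι y - ι x) u (ι κ))) ⟩
        ι x + (ι y - ι x) * u * ι κ            ∎)
      where open import Relation.Binary.Reasoning.Setoid (mod-setoid {n})
            identity : ∀ y x → y ≡ x + (y - x) * + 1
            identity = solve-∀

    StepSign : Sign → Fin n → Set
    StepSign s x = ι (T i (x ⊕ κ)) ≡ ι (T i x) + unit s * ι κ′ mod n

    step-sign : ∀ x → ∃ λ s → StepSign s x
    step-sign x with inner-arc (g-preserves (inj₁ (cyc i x)))
    ... | inj₁ e = Sign.+ , mod-trans (mod-reflexive (cong ι e))
                     (mod-trans (ι-⊕ (T i x) κ′) (+-congˡ (ι (T i x)) (mod-reflexive (sym (ℤ.*-identityˡ (ι κ′))))))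
    ... | inj₂ e = Sign.- , mod-trans (mod-reflexive (identity (ι (T i (x ⊕ κ))) (ι κ′)))
                     (+-congʳ (- + 1 * ι κ′) (mod-trans (mod-sym (ι-⊕ _ κ′)) (mod-reflexive (cong ι (sym e)))))
      where identity : ∀ b c → b ≡ (b + c) + - + 1 * c
            identity = solve-∀

    -- A change of direction would make T i identify x and x ⊕ 2κ, but 2κ ≢ 0 since κ is a unit.
    private
      no-reversal : ∀ s s′ {x} → StepSign s x → StepSign s′ (x ⊕ κ) → unit s + unit s′ ≡ + 0 → ⊥
      no-reversal s s′ {x} p q cancel = Coprime⇒double≢0 2<n (coprime i) (+-cancelˡ (ι x) (begin
          ι x + + 2 * ι κ              ≡⟨ identity (ι x) (ι κ) ⟩
          ι x + ι κ + ι κ              ≈⟨ mod-sym (mod-trans (ι-⊕ (x ⊕ κ) κ) (+-congʳ (ι κ) (ι-⊕ x κ))) ⟩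
          ι ((x ⊕ κ) ⊕ κ)              ≡⟨ cong ι (T-injective i (ι-injective T-returns)) ⟩
          ι x                          ≡⟨ ℤ.+-identityʳ (ι x) ⟨
          ι x + + 0                    ∎))
        where
          open import Relation.Binary.Reasoning.Setoid (mod-setoid {n})
          identity : ∀ a b → a + + 2 * b ≡ a + b + b
          identity = solve-∀
          regroup : ∀ a u u′ b → a + u * b + u′ * b ≡ a + (u + u′) * b
          regroup = solve-∀
          T-returns : ι (T i ((x ⊕ κ) ⊕ κ)) ≡ ι (T i x) mod n
          T-returns = begin
            ι (T i ((x ⊕ κ) ⊕ κ))                      ≈⟨ q ⟩
            ι (T i (x ⊕ κ)) + unit s′ * ι κ′           ≈⟨ +-congʳ (unit s′ * ι κ′) p ⟩
            ι (T i x) + unit s * ι κ′ + unit s′ * ι κ′ ≡⟨ regroup (ι (T i x)) (unit s) (unit s′) (ι κ′) ⟩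
            ι (T i x) + (unit s + unit s′) * ι κ′      ≡⟨ cong (λ c → ι (T i x) + c * ι κ′) cancel ⟩
            ι (T i x) + + 0 * ι κ′                     ≡⟨ ℤ.+-identityʳ (ι (T i x)) ⟩
            ι (T i x)                                  ∎

    step-sign-propagates : ∀ s {x} → StepSign s x → StepSign s (x ⊕ κ)
    step-sign-propagates s {x} p with step-sign (x ⊕ κ)
    ... | s′ , q with s | s′
    ... | Sign.+ | Sign.+ = q
    ... | Sign.- | Sign.- = q
    ... | Sign.+ | Sign.- = ⊥-elim (no-reversal Sign.+ Sign.- p q refl)
    ... | Sign.- | Sign.+ = ⊥-elim (no-reversal Sign.- Sign.+ p q refl)

    step-sign-iterate : ∀ s {x} → StepSign s x → ∀ t → StepSign s (iterate t x)
    step-sign-iterate s p zero    = p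
    step-sign-iterate s p (suc t) = step-sign-propagates s (step-sign-iterate s p t)

    rotation : Sign
    rotation = proj₁ (step-sign (toZ 0))

    slope : ℤ
    slope = unit rotation * ι κ′

    slope≡±k : slope ≡± ι κ′ mod n
    slope≡±k = rotation , mod-refl

    slope-odd : slope ≡ + 1 mod 2
    slope-odd = *-cong (unit-odd rotation) (Coprime⇒odd 2∣n (coprime (L i)))

    T-step : ∀ x → ι (T i (x ⊕ κ)) ≡ ι (T i x) + slope mod n
    T-step x = subst (StepSign rotation) (proj₂ reach)
      (step-sign-iterate rotation (proj₂ (step-sign (toZ 0))) (proj₁ reach))
      where reach : ∃ λ t → iterate t (toZ 0) ≡ x
            reach = iterate-reaches (toZ 0) x

    T-iterate : ∀ t x → ι (T i (iterate t x)) ≡ ι (T i x) + + t * slope mod n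
    T-iterate zero    x = mod-reflexive (identity (ι (T i x)) slope)
      where identity : ∀ a b → a ≡ a + + 0 * b
            identity = solve-∀
    T-iterate (suc t) x = mod-trans (T-step (iterate t x))
      (mod-trans (+-congʳ slope (T-iterate t x)) (mod-reflexive (identity (ι (T i x)) (+ t) slope)))
      where identity : ∀ a t b → a + t * b + b ≡ a + (+ 1 + t) * b
            identity = solve-∀

    T-affine : ∀ {x y} c → ι y ≡ ι x + c * ι κ mod n → ι (T i y) ≡ ι (T i x) + c * slope mod n
    T-affine {x} c y≡ = subst (λ z → ι (T i z) ≡ ι (T i x) + c * slope mod n) (iterate-hits t c c≡t y≡)
        (mod-trans (T-iterate t x) (+-congˡ (ι (T i x)) (*-congʳ slope (mod-sym c≡t))))
      where t : ℕ
            t = proj₁ (ℤ-residue c)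
            c≡t : c ≡ + t mod n
            c≡t = proj₂ (ℤ-residue c)

module Setting (m n : ℕ) {{_ : NonZero n}} (3≤m : 3 ≤ m) (2<n : 2 < n) (2∣n : 2 ℕ.∣ n)
    (k : Fin m → Fin n) (ℓ : Fin n) (ℓ≡m : ι ℓ ≡ + m mod 2)
    (k₀≡1 : ∀ i → toℕ i ≡ 0 → k i ≡ toZ 1) (coprime : ∀ i → Coprime (toℕ (k i)) n)
    (G : Aut m n k ℓ → Set) (transitive : VertexTransitive G) (preserves : PreservesC G) where

  open Graph m n k ℓ 3≤m 2∣n ℓ≡m

  layer₀ layer₁ : Fin m
  layer₀ = fromℕ< (ℕ.≤-trans (ℕ.s≤s ℕ.z≤n) 3≤m)
  layer₁ = fromℕ< (ℕ.≤-trans (ℕ.s≤s (ℕ.s≤s ℕ.z≤n)) 3≤m)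

  toℕ-layer₀ : toℕ layer₀ ≡ 0
  toℕ-layer₀ = toℕ-fromℕ< _

  toℕ-layer₁ : toℕ layer₁ ≡ suc (toℕ layer₀)
  toℕ-layer₁ = trans (toℕ-fromℕ< _) (cong suc (sym toℕ-layer₀))

  toℕ-fromℕ<-suc : ∀ {α} (h : suc α < m) → toℕ (fromℕ< h) ≡ suc (toℕ (fromℕ< (ℕ.<⇒≤ h)))
  toℕ-fromℕ<-suc h = trans (toℕ-fromℕ< h) (cong suc (sym (toℕ-fromℕ< _)))

  0ₙ 1ₙ : Fin n
  0ₙ = toZ 0
  1ₙ = toZ 1

  origin : Vertex m n
  origin = layer₀ , 0ₙ

  K : Fin m → ℤ
  K a = ι (k a)

  K₁ : ℤ
  K₁ = K layer₁

  K-first : ∀ {a} → toℕ a ≡ 0 → K a ≡ + 1 mod n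
  K-first e = mod-trans (mod-reflexive (cong ι (k₀≡1 _ e))) (ι-toZ 1)

  K-odd : ∀ a → K a ≡ + 1 mod 2
  K-odd a = Coprime⇒odd 2∣n (coprime a)

  even⇒layer₀-parity : ∀ {x : Fin n} → ι x ≡ + 0 mod 2 → ι x ≡ ι layer₀ mod 2
  even⇒layer₀-parity e = mod-trans e (mod-reflexive (cong +_ (sym toℕ-layer₀)))

  0ₙ-even : ι 0ₙ ≡ + 0 mod 2
  0ₙ-even = mod-weaken 2∣n (ι-toZ 0)

  toZ-toℕ-parity : ∀ (a : Fin m) → ι (toZ {n} (toℕ a)) ≡ ι a mod 2
  toZ-toℕ-parity a = mod-weaken 2∣n (ι-toZ (toℕ a))

  up-from-layer₀ : ∀ {x : Fin n} → ι x ≡ + 0 mod 2 → OuterArc layer₀ x layer₁ x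
  up-from-layer₀ x-even = up toℕ-layer₁ (even⇒layer₀-parity x-even)

  twice-k₁ : Fin n
  twice-k₁ = k layer₁ ⊕ k layer₁

  ι-twice-k₁ : ι twice-k₁ ≡ + 2 * K₁ mod n
  ι-twice-k₁ = mod-trans (ι-⊕ (k layer₁) (k layer₁)) (mod-reflexive (identity K₁))
    where identity : ∀ a → a + a ≡ + 2 * a
          identity = solve-∀

  twice-k₁-even : ι twice-k₁ ≡ + 0 mod 2
  twice-k₁-even = mod-trans (mod-weaken 2∣n ι-twice-k₁) (double≡0-mod-2 K₁)

  offset-from-0ₙ : ∀ {x : Fin n} {c} → ι x ≡ c mod n → ι x ≡ ι 0ₙ + c mod n
  offset-from-0ₙ {c = c} e =
    mod-trans e (mod-trans (mod-reflexive (sym (ℤ.+-identityˡ c))) (+-congʳ c (mod-sym (ι-toZ 0))))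

  odd-step : ∀ {x y u c} → x ≡ y + u mod n → y ≡ c mod 2 → u ≡ + 1 mod 2 → x ≡ + 1 + c mod 2
  odd-step {c = c} x≡ y≡ u≡ =
    mod-trans (mod-weaken 2∣n x≡) (mod-trans (+-cong y≡ u≡) (mod-reflexive (ℤ.+-comm c (+ 1))))

  module MovingOriginTo (v : Vertex m n) where

    private
      witness : Σ (Aut m n k ℓ) λ g → G g × fun g origin ≡ v
      witness = transitive origin v

    g : Aut m n k ℓ
    g = proj₁ witness

    open LayerAutomorphism m n k ℓ 3≤m 2∣n ℓ≡m 2<n coprime g (preserves g (proj₁ (proj₂ witness))) public

    g-origin : fun g origin ≡ v
    g-origin = proj₂ (proj₂ witness)

  -- The point twice-k₁ lies 2k₁ steps from 0ₙ along C₀ (as k₀ = 1) but two steps along C₁.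
  double-K₁K≡±double-K : ∀ {b b′ : Fin m} {y s : Fin n} →
    (∀ w → ι w ≡ ι y mod 2 → OuterArc b w b′ (w ⊕ s)) → + 2 * K₁ * K b ≡± + 2 * K b′ mod n
  double-K₁K≡±double-K {b} {b′} {y} {s} partner =
    ±-trans (±-*-congˡ (+ 2 * K₁) (±-sym (subst (λ a → slope layer₀ ≡± K a mod n) L₀≡b (slope≡±k layer₀))))
   (±-trans (mod⇒± slopes)
            (±-*-congˡ (+ 2) (subst (λ a → slope layer₁ ≡± K a mod n) L₁≡b′ (slope≡±k layer₁))))
    where
      open MovingOriginTo (b , y)
      open import Relation.Binary.Reasoning.Setoid (mod-setoid {n})
      L₀≡b : L layer₀ ≡ b
      L₀≡b = proj₁ (g-split g-origin)
      T₀-twice-k₁ : ι (T layer₀ twice-k₁) ≡ ι y + + 2 * K₁ * slope layer₀ mod n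
      T₀-twice-k₁ = subst (λ t → ι (T layer₀ twice-k₁) ≡ ι t + + 2 * K₁ * slope layer₀ mod n)
        (proj₂ (g-split g-origin))
        (T-affine layer₀ (+ 2 * K₁) (offset-from-0ₙ (mod-trans ι-twice-k₁ (mod-sym (mod-trans
          (*-congˡ (+ 2 * K₁) (K-first toℕ-layer₀)) (mod-reflexive (ℤ.*-identityʳ (+ 2 * K₁))))))))
      T₀-twice-k₁-parity : ι (T layer₀ twice-k₁) ≡ ι y mod 2
      T₀-twice-k₁-parity = mod-trans (mod-weaken 2∣n T₀-twice-k₁) (mod-trans
        (+-congˡ (ι y) (*-congʳ (slope layer₀) (double≡0-mod-2 K₁))) (mod-reflexive (ℤ.+-identityʳ (ι y))))
      g-1-0ₙ : fun g (layer₁ , 0ₙ) ≡ (b′ , y ⊕ s)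
      g-1-0ₙ = outer-transport g-origin (up-from-layer₀ 0ₙ-even) (partner y mod-refl)
      g-1-twice-k₁ : fun g (layer₁ , twice-k₁) ≡ (b′ , T layer₀ twice-k₁ ⊕ s)
      g-1-twice-k₁ = outer-transport (trans (g-on-layer layer₀ twice-k₁) (cong (_, T layer₀ twice-k₁) L₀≡b))
        (up-from-layer₀ twice-k₁-even) (partner _ T₀-twice-k₁-parity)
      L₁≡b′ : L layer₁ ≡ b′
      L₁≡b′ = proj₁ (g-split g-1-0ₙ)
      slopes : + 2 * K₁ * slope layer₀ ≡ + 2 * slope layer₁ mod n
      slopes = +-cancelˡ (ι y + ι s) {x = + 2 * K₁ * slope layer₀} {y = + 2 * slope layer₁} (begin
        ι y + ι s + + 2 * K₁ * slope layer₀    ≡⟨ identity (ι y) (ι s) (+ 2 * K₁ * slope layer₀) ⟩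
        ι y + + 2 * K₁ * slope layer₀ + ι s    ≈⟨ +-congʳ (ι s) (mod-sym T₀-twice-k₁) ⟩
        ι (T layer₀ twice-k₁) + ι s            ≈⟨ mod-sym (ι-⊕ _ s) ⟩
        ι (T layer₀ twice-k₁ ⊕ s)              ≡⟨ cong ι (proj₂ (g-split g-1-twice-k₁)) ⟨
        ι (T layer₁ twice-k₁)                  ≈⟨ T-affine layer₁ (+ 2) (offset-from-0ₙ ι-twice-k₁) ⟩
        ι (T layer₁ 0ₙ) + + 2 * slope layer₁   ≡⟨ cong (λ t → ι t + + 2 * slope layer₁) (proj₂ (g-split g-1-0ₙ)) ⟩
        ι (y ⊕ s) + + 2 * slope layer₁         ≈⟨ +-congʳ (+ 2 * slope layer₁) (ι-⊕ y s) ⟩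
        ι y + ι s + + 2 * slope layer₁         ∎)
        where identity : ∀ a b c → a + b + c ≡ a + c + b
              identity = solve-∀

  double-K₁K₁≡±2 : + 2 * K₁ * K₁ ≡± + 2 mod n
  double-K₁K₁≡±2 = ±-trans (double-K₁K≡±double-K partner) (mod⇒± (*-congˡ (+ 2) (K-first toℕ-layer₀)))
    where
      partner : ∀ w → ι w ≡ ι 0ₙ mod 2 → OuterArc layer₁ w layer₀ (w ⊕ 0ₙ)
      partner w w-even = subst (OuterArc layer₁ w layer₀) (sym (⊕-identityʳ w))
        (down toℕ-layer₁ (even⇒layer₀-parity (mod-trans w-even 0ₙ-even)))

  double-K₁K≡±double-K-next : ∀ {a a′ : Fin m} → toℕ a′ ≡ suc (toℕ a) → + 2 * K₁ * K a ≡± + 2 * K a′ mod n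
  double-K₁K≡±double-K-next {a} {a′} e = double-K₁K≡±double-K partner
    where
      partner : ∀ w → ι w ≡ ι (toZ {n} (toℕ a)) mod 2 → OuterArc a w a′ (w ⊕ 0ₙ)
      partner w w-parity = subst (OuterArc a w a′) (sym (⊕-identityʳ w))
        (up e (mod-trans w-parity (toZ-toℕ-parity a)))

  double-K₁K-last≡±2 : ∀ {a : Fin m} → suc (toℕ a) ≡ m → + 2 * K₁ * K a ≡± + 2 mod n
  double-K₁K-last≡±2 {a} e = ±-trans (double-K₁K≡±double-K partner) (mod⇒± (*-congˡ (+ 2) (K-first toℕ-layer₀)))
    where
      partner : ∀ w → ι w ≡ ι (toZ {n} (toℕ a)) mod 2 → OuterArc a w layer₀ (w ⊕ ℓ)
      partner w w-parity = wrap e toℕ-layer₀ (mod-trans w-parity (toZ-toℕ-parity a))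

  double-K≡±double-K₁^ : ∀ α (h : α < m) → + 2 * K (fromℕ< h) ≡± + 2 * K₁ ^ α mod n
  double-K≡±double-K₁^ zero    h = mod⇒± (*-congˡ (+ 2) (K-first (toℕ-fromℕ< h)))
  double-K≡±double-K₁^ (suc α) h =
    ±-trans (±-sym (double-K₁K≡±double-K-next {fromℕ< (ℕ.<⇒≤ h)} {fromℕ< h} (toℕ-fromℕ<-suc h)))
   (±-trans (mod⇒± (mod-reflexive (identity₁ K₁ (K (fromℕ< (ℕ.<⇒≤ h))))))
   (±-trans (±-*-congˡ K₁ (double-K≡±double-K₁^ α (ℕ.<⇒≤ h)))
            (mod⇒± (mod-reflexive (identity₂ K₁ (K₁ ^ α))))))
    where
      identity₁ : ∀ a b → + 2 * a * b ≡ a * (+ 2 * b)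
      identity₁ = solve-∀
      identity₂ : ∀ a b → a * (+ 2 * b) ≡ + 2 * (a * b)
      identity₂ = solve-∀

  ε : Sign
  ε = _≡±_mod_.sign double-K₁K₁≡±2

  E : ℤ
  E = unit ε

  double-K₁K₁≡double-E : + 2 * (K₁ * K₁) ≡ + 2 * E mod n
  double-K₁K₁≡double-E = mod-trans (mod-reflexive (sym (ℤ.*-assoc (+ 2) K₁ K₁)))
    (mod-trans (_≡±_mod_.congruence double-K₁K₁≡±2) (mod-reflexive (ℤ.*-comm E (+ 2))))

  double-K²≡double-E^ : ∀ i → + 2 * (K i * K i) ≡ + 2 * E ^ toℕ i mod n
  double-K²≡double-E^ i = mod-trans
    (subst (λ a → + 2 * (K a * K a) ≡ + 2 * (K₁ ^ toℕ i * K₁ ^ toℕ i) mod n) (fromℕ<-toℕ i (toℕ<n i))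
           (±-square {n = n} {x = K (fromℕ< (toℕ<n i))} (double-K≡±double-K₁^ (toℕ i) (toℕ<n i))))
    (double-square-^ double-K₁K₁≡double-E (toℕ i))

  m-odd⇒double-E≡2 : m % 2 ≡ 1 → + 2 * E ≡ + 2 mod n
  m-odd⇒double-E≡2 m-odd =
    mod-trans (mod-sym double-K₁K₁≡double-E) (±-square {n = n} {x = K₁} {y = + 1} double-K₁≡±2)
    where
      q : ℕ
      q = m / 2
      m≡2q+1 : m ≡ suc (q ℕ.+ q)
      m≡2q+1 = trans (m≡m%n+[m/n]*n m 2)
        (cong₂ ℕ._+_ m-odd (trans (ℕ.*-comm q 2) (cong (q ℕ.+_) (ℕ.+-identityʳ q))))
      h : q ℕ.+ q < m
      h = subst (q ℕ.+ q <_) (sym m≡2q+1) ℕ.≤-refl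
      last : Fin m
      last = fromℕ< h
      double-K-last≡±2 : + 2 * K last ≡± + 2 mod n
      double-K-last≡±2 = ±-trans (double-K≡±double-K₁^ (q ℕ.+ q) h)
        (±-trans (mod⇒± (mod-trans (mod-reflexive (cong (+ 2 *_) (ℤ.^-distribˡ-+-* K₁ q q)))
                                   (double-square-^ double-K₁K₁≡double-E q)))
                 (double-unit-^ ε q))
      double-K₁≡±2 : + 2 * K₁ ≡± + 2 * + 1 mod n
      double-K₁≡±2 =
        ±-trans (mod⇒± (mod-reflexive (ℤ.*-comm (+ 2) K₁)))
       (±-trans (±-*-congˡ K₁ (±-sym double-K-last≡±2))
       (±-trans (mod⇒± (mod-reflexive (identity K₁ (K last))))
                (double-K₁K-last≡±2 (trans (cong suc (toℕ-fromℕ< h)) (sym m≡2q+1)))))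
        where identity : ∀ a b → a * (+ 2 * b) ≡ + 2 * a * b
              identity = solve-∀

  shift : Sign → Fin n → Fin n → Fin n
  shift Sign.+ x κ = x ⊕ κ
  shift Sign.- x κ = x ⊕ (⊖ κ)

  ι-shift : ∀ s x κ → ι (shift s x κ) ≡ ι x + unit s * ι κ mod n
  ι-shift Sign.+ x κ = mod-trans (ι-⊕ x κ) (+-congˡ (ι x) (mod-reflexive (sym (ℤ.*-identityˡ (ι κ)))))
  ι-shift Sign.- x κ = mod-trans (ι-⊕ x (⊖ κ))
    (+-congˡ (ι x) (mod-trans (ι-⊖ κ) (mod-reflexive (sym (ℤ.-1*i≡-i (ι κ))))))

  shift-parity : ∀ {a b : Fin m} {P : Fin n} → toℕ b ≡ suc (toℕ a) → ι P ≡ ι a mod 2 →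
                 ∀ s → ι (shift s P (k b)) ≡ ι b mod 2
  shift-parity {b = b} {P} e P-parity s = mod-trans
    (odd-step (ι-shift s P (k b)) P-parity (*-cong (unit-odd s) (K-odd b))) (mod-reflexive (cong +_ (sym e)))

  symmetric-sum : ∀ {x y} a b c → x ≡ a + + 1 * c mod n → y ≡ b + - + 1 * c mod n → x + y ≡ a + b mod n
  symmetric-sum a b c x≡ y≡ = mod-trans (+-cong x≡ y≡) (mod-reflexive (identity a b c))
    where identity : ∀ a b c → (a + + 1 * c) + (b + - + 1 * c) ≡ a + b
          identity = solve-∀

  -- With g(u_{0,0}) = u_{1,1}, follow two points P and P′ = -P layer by layer, moving them by +k
  -- and -k: the unknown sign of each slope cancels in the sums P + P′ and g(P) + g(P′).
  module Spiral where

    open MovingOriginTo (layer₁ , 1ₙ) public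

    record Tracked (a b : Fin m) (P Y : Fin n) : Set where
      field
        P-parity : ι P ≡ ι a mod 2
        Y-parity : ι Y ≡ ι b mod 2
        maps-to  : fun g (a , P) ≡ (b , Y)

    climb : ∀ {a b c P Y Z} → toℕ b ≡ suc (toℕ a) → Tracked a b P Y → OuterArc b Y c Z → fun g (b , P) ≡ (c , Z)
    climb e t = outer-transport (Tracked.maps-to t) (up e (Tracked.P-parity t))

    shifted : ∀ {b c P Z} → fun g (b , P) ≡ (c , Z) → ∀ s →
              fun g (b , shift s P (k b)) ≡ (c , T b (shift s P (k b))) ×
              (ι (T b (shift s P (k b))) ≡ ι Z + unit s * slope b mod n)
    shifted {b} {c} {P} {Z} e s =
      trans (g-on-layer b _) (cong (_, _) (proj₁ (g-split e))) ,
      subst (λ t → ι (T b (shift s P (k b))) ≡ ι t + unit s * slope b mod n) (proj₂ (g-split e))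
            (T-affine b (unit s) (ι-shift s P (k b)))

    advance : ∀ {a b c P Y} → toℕ b ≡ suc (toℕ a) → toℕ c ≡ suc (toℕ b) → Tracked a b P Y → ∀ s →
              Tracked b c (shift s P (k b)) (T b (shift s P (k b))) ×
              (ι (T b (shift s P (k b))) ≡ ι Y + unit s * slope b mod n)
    advance {a} {b} {c} {P} {Y} e e′ t s = tracked , image
      where
        open Tracked t
        climbed : fun g (b , P) ≡ (c , Y)
        climbed = climb e t (up e′ Y-parity)
        image : ι (T b (shift s P (k b))) ≡ ι Y + unit s * slope b mod n
        image = proj₂ (shifted climbed s)
        tracked : Tracked b c (shift s P (k b)) (T b (shift s P (k b)))
        tracked = record
          { P-parity = shift-parity e P-parity s
          ; Y-parity = mod-trans (odd-step image Y-parity (*-cong (unit-odd s) (slope-odd b)))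
                                 (mod-reflexive (cong +_ (sym e′)))
          ; maps-to  = proj₁ (shifted climbed s) }

    record SymmetricPair (a b : Fin m) : Set where
      field
        P P′ Y Y′ : Fin n
        tracked  : Tracked a b P Y
        tracked′ : Tracked a b P′ Y′
        P-sum    : ι P + ι P′ ≡ + 0 mod n
        Y-sum    : ι Y + ι Y′ ≡ + 2 mod n

    initial-pair : SymmetricPair layer₀ layer₁
    initial-pair = record
      { tracked  = tracked
      ; tracked′ = tracked
      ; P-sum    = +-cong (ι-toZ 0) (ι-toZ 0)
      ; Y-sum    = +-cong (ι-toZ 1) (ι-toZ 1) }
      where
        tracked : Tracked layer₀ layer₁ 0ₙ 1ₙ
        tracked = record
          { P-parity = even⇒layer₀-parity 0ₙ-even
          ; Y-parity = mod-trans (mod-weaken 2∣n (ι-toZ 1)) (mod-reflexive (cong +_ (sym (toℕ-fromℕ< _))))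
          ; maps-to  = g-origin }

    advance-pair : ∀ {a b c} → toℕ b ≡ suc (toℕ a) → toℕ c ≡ suc (toℕ b) → SymmetricPair a b → SymmetricPair b c
    advance-pair {b = b} e e′ pair = record
      { tracked  = proj₁ (advance e e′ tracked Sign.+)
      ; tracked′ = proj₁ (advance e e′ tracked′ Sign.-)
      ; P-sum    = mod-trans (symmetric-sum (ι P) (ι P′) (K b) (ι-shift Sign.+ P (k b)) (ι-shift Sign.- P′ (k b))) P-sum
      ; Y-sum    = mod-trans (symmetric-sum (ι Y) (ι Y′) (slope b)
                     (proj₂ (advance e e′ tracked Sign.+)) (proj₂ (advance e e′ tracked′ Sign.-))) Y-sum }
      where open SymmetricPair pair

    pair-at : ∀ α (h : suc α < m) → SymmetricPair (fromℕ< (ℕ.<⇒≤ h)) (fromℕ< h)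
    pair-at zero    h = initial-pair
    pair-at (suc α) h = advance-pair (toℕ-fromℕ<-suc (ℕ.<⇒≤ h)) (toℕ-fromℕ<-suc h) (pair-at α (ℕ.<⇒≤ h))

    -- Past the last layer a tracked point wraps to C₀, whose map T layer₀ is known exactly.
    wrap-around : ∀ {a b P Y} → toℕ b ≡ suc (toℕ a) → suc (toℕ b) ≡ m → Tracked a b P Y → ∀ s →
      ι Y + ι ℓ + unit s * slope b ≡ ι 1ₙ + (ι P + unit s * K b + ι ℓ) * slope layer₀ mod n
    wrap-around {a} {b} {P} {Y} e last t s = begin
        ι Y + ι ℓ + unit s * slope b
          ≈⟨ +-congʳ (unit s * slope b) (mod-sym (ι-⊕ Y ℓ)) ⟩
        ι (Y ⊕ ℓ) + unit s * slope b
          ≈⟨ mod-sym image ⟩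
        ι (T b P₊)
          ≡⟨ cong ι (proj₂ (g-split g-P₊ℓ)) ⟨
        ι (T layer₀ (P₊ ⊕ ℓ))
          ≈⟨ T-affine layer₀ (ι (P₊ ⊕ ℓ)) (offset-from-0ₙ times-K₀) ⟩
        ι (T layer₀ 0ₙ) + ι (P₊ ⊕ ℓ) * slope layer₀
          ≡⟨ cong (λ z → ι z + ι (P₊ ⊕ ℓ) * slope layer₀) T₀0ₙ≡1ₙ ⟩
        ι 1ₙ + ι (P₊ ⊕ ℓ) * slope layer₀
          ≈⟨ +-congˡ (ι 1ₙ) (*-congʳ (slope layer₀) ι-P₊ℓ) ⟩
        ι 1ₙ + (ι P + unit s * K b + ι ℓ) * slope layer₀ ∎
      where
        open import Relation.Binary.Reasoning.Setoid (mod-setoid {n})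
        open Tracked t
        P₊ : Fin n
        P₊ = shift s P (k b)
        wrapped : fun g (b , P) ≡ (layer₀ , Y ⊕ ℓ)
        wrapped = climb e t (wrap last toℕ-layer₀ Y-parity)
        image : ι (T b P₊) ≡ ι (Y ⊕ ℓ) + unit s * slope b mod n
        image = proj₂ (shifted wrapped s)
        Yℓ-parity : ι (Y ⊕ ℓ) ≡ ι b + + m mod 2
        Yℓ-parity = mod-trans (mod-weaken 2∣n (ι-⊕ Y ℓ)) (+-cong Y-parity ℓ≡m)
        image-even : ι (T b P₊) ≡ + 0 mod 2
        image-even = mod-trans (odd-step image Yℓ-parity (*-cong (unit-odd s) (slope-odd b)))
          (mod-trans (mod-reflexive (cong (λ t → + (t ℕ.+ m)) last))
                     (mod-trans (mod-reflexive (identity (+ m))) (double≡0-mod-2 (+ m))))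
          where identity : ∀ x → x + x ≡ + 2 * x
                identity = solve-∀
        g-P₊ℓ : fun g (layer₀ , P₊ ⊕ ℓ) ≡ (layer₁ , T b P₊)
        g-P₊ℓ = outer-transport (proj₁ (shifted wrapped s)) (wrap last toℕ-layer₀ (shift-parity e P-parity s))
                                (up toℕ-layer₁ (even⇒layer₀-parity image-even))
        times-K₀ : ι (P₊ ⊕ ℓ) ≡ ι (P₊ ⊕ ℓ) * K layer₀ mod n
        times-K₀ = mod-sym (mod-trans (*-congˡ (ι (P₊ ⊕ ℓ)) (K-first toℕ-layer₀))
                                      (mod-reflexive (ℤ.*-identityʳ (ι (P₊ ⊕ ℓ)))))
        T₀0ₙ≡1ₙ : T layer₀ 0ₙ ≡ 1ₙ
        T₀0ₙ≡1ₙ = proj₂ (g-split g-origin)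
        ι-P₊ℓ : ι (P₊ ⊕ ℓ) ≡ ι P + unit s * K b + ι ℓ mod n
        ι-P₊ℓ = mod-trans (ι-⊕ P₊ ℓ) (+-congʳ (ι ℓ) (ι-shift s P (k b)))

    double-ℓ-slope₀≡double-ℓ : + 2 * ι ℓ * slope layer₀ ≡ + 2 * ι ℓ mod n
    double-ℓ-slope₀≡double-ℓ = +-cancelˡ (+ 2) (begin
        + 2 + + 2 * ι ℓ * σ₀
          ≈⟨ +-congʳ (+ 2 * ι ℓ * σ₀) (mod-sym two-halves) ⟩
        (ι 1ₙ + ι 1ₙ) + (ι P + ι P′) * σ₀ + + 2 * ι ℓ * σ₀
          ≡⟨ identity₁ (ι 1ₙ) (ι P) (ι P′) (K b) (ι ℓ) σ₀ ⟩
        (ι 1ₙ + (ι P + + 1 * K b + ι ℓ) * σ₀) + (ι 1ₙ + (ι P′ + - + 1 * K b + ι ℓ) * σ₀)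
          ≈⟨ mod-sym (+-cong (wrap-around e last tracked Sign.+) (wrap-around e last tracked′ Sign.-)) ⟩
        (ι Y + ι ℓ + + 1 * slope b) + (ι Y′ + ι ℓ + - + 1 * slope b)
          ≡⟨ identity₂ (ι Y) (ι Y′) (ι ℓ) (slope b) ⟩
        (ι Y + ι Y′) + + 2 * ι ℓ
          ≈⟨ +-congʳ (+ 2 * ι ℓ) Y-sum ⟩
        + 2 + + 2 * ι ℓ ∎)
      where
        open import Relation.Binary.Reasoning.Setoid (mod-setoid {n})
        μ : ℕ
        μ = m ℕ.∸ 2
        2+μ≡m : suc (suc μ) ≡ m
        2+μ≡m = ℕ.m+[n∸m]≡n (ℕ.≤-trans (ℕ.s≤s (ℕ.s≤s ℕ.z≤n)) 3≤m)
        h : suc μ < m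
        h = subst (suc μ <_) 2+μ≡m ℕ.≤-refl
        b : Fin m
        b = fromℕ< h
        e : toℕ b ≡ suc (toℕ (fromℕ< (ℕ.<⇒≤ h)))
        e = toℕ-fromℕ<-suc h
        last : suc (toℕ b) ≡ m
        last = trans (cong suc (toℕ-fromℕ< h)) 2+μ≡m
        σ₀ : ℤ
        σ₀ = slope layer₀
        open SymmetricPair (pair-at μ h)
        two-halves : (ι 1ₙ + ι 1ₙ) + (ι P + ι P′) * σ₀ ≡ + 2 mod n
        two-halves = +-cong (+-cong (ι-toZ 1) (ι-toZ 1)) (*-congʳ σ₀ P-sum)
        identity₁ : ∀ o p p′ c l σ → (o + o) + (p + p′) * σ + + 2 * l * σ ≡
                    (o + (p + + 1 * c + l) * σ) + (o + (p′ + - + 1 * c + l) * σ)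
        identity₁ = solve-∀
        identity₂ : ∀ y y′ l c → (y + l + + 1 * c) + (y′ + l + - + 1 * c) ≡ (y + y′) + + 2 * l
        identity₂ = solve-∀

  m-even⇒double-ℓ≡0 : m % 2 ≡ 0 → + 2 * E ≡ - + 2 mod n → + 2 * ι ℓ ≡ + 0 mod n
  m-even⇒double-ℓ≡0 m-even double-E≡-2 =
    double-fixed-by-±odd⇒≡0 (rotation layer₀) (+ (toℕ ℓ / 2)) (+ (toℕ (k layer₁) / 2))
      ℓ≡2r K₁≡1+2w (mod-trans double-K₁K₁≡double-E double-E≡-2) fixed
    where
      open Spiral
      ℓ≡2r : ι ℓ ≡ + 2 * + (toℕ ℓ / 2)
      ℓ≡2r = trans (parity-decomposition (toℕ ℓ))
        (trans (cong (λ r → + r + + 2 * + (toℕ ℓ / 2)) (trans (mod⇒% ℓ≡m) m-even)) (ℤ.+-identityˡ _))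
      K₁≡1+2w : K₁ ≡ + 1 + + 2 * + (toℕ (k layer₁) / 2)
      K₁≡1+2w = trans (parity-decomposition (toℕ (k layer₁)))
        (cong (λ r → + r + + 2 * + (toℕ (k layer₁) / 2)) (mod⇒% (K-odd layer₁)))
      fixed : + 2 * ι ℓ * (unit (rotation layer₀) * K₁) ≡ + 2 * ι ℓ mod n
      fixed = subst (λ a → + 2 * ι ℓ * (unit (rotation layer₀) * K a) ≡ + 2 * ι ℓ mod n)
                    (proj₁ (g-split g-origin)) double-ℓ-slope₀≡double-ℓ

  double-K²≡±2 : ∀ i → + 2 * (K i * K i) ≡ + 2 mod n ⊎ + 2 * (K i * K i) ≡ - + 2 mod n
  double-K²≡±2 i = ±⇒⊎ (±-trans (mod⇒± (double-K²≡double-E^ i)) (double-unit-^ ε (toℕ i)))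

  double-K²≡2 : ¬ (+ 2 * ι ℓ ≡ + 0 mod n) → ∀ i → + 2 * (K i * K i) ≡ + 2 mod n
  double-K²≡2 double-ℓ≢0 i = mod-trans (double-K²≡double-E^ i) (double-fixed-^ double-E≡2 (toℕ i))
    where
      by-cases : + 2 * E ≡ + 2 ⊎ + 2 * E ≡ - + 2 → m % 2 ≡ 0 ⊎ m % 2 ≡ 1 → + 2 * E ≡ + 2 mod n
      by-cases (inj₁ e) _             = mod-reflexive e
      by-cases (inj₂ e) (inj₁ m-even) = ⊥-elim (double-ℓ≢0 (m-even⇒double-ℓ≡0 m-even (mod-reflexive e)))
      by-cases (inj₂ _) (inj₂ m-odd)  = m-odd⇒double-E≡2 m-odd
      double-E≡2 : + 2 * E ≡ + 2 mod n
      double-E≡2 = by-cases (double-unit-cases ε) (%2-split m)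

lemma5p5 : (m n : ℕ) {{_ : NonZero n}} → 3 ≤ m → 6 ≤ n → n % 2 ≡ 0 →
    (k : Fin m → Fin n) (ℓ : Fin n) →
    toℕ ℓ % 2 ≡ m % 2 →
    (∀ i → toℕ i ≡ 0 → k i ≡ toZ 1) →
    (∀ i → Coprime (toℕ (k i)) n) →
    (G : Aut m n k ℓ → Set) → IsSubgroup G → VertexTransitive G → PreservesC G →
    (∀ i → (toZ 2 ⊗ (k i ⊗ k i) ≡ toZ 2) ⊎ (toZ 2 ⊗ (k i ⊗ k i) ≡ ⊖ toZ 2))
    × (¬ (toZ 2 ⊗ ℓ ≡ toZ 0) → ∀ i → toZ 2 ⊗ (k i ⊗ k i) ≡ toZ 2)
lemma5p5 m n 3≤m 6≤n n-even k ℓ ℓ-parity k₀≡1 coprime G _ transitive preserves =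
  (λ i → Sum.map (double-K²≡⇒ i (ι-toZ 2)) (double-K²≡⇒ i ι-⊖2) (double-K²≡±2 i)) ,
  (λ 2ℓ≢0 i → double-K²≡⇒ i (ι-toZ 2) (double-K²≡2 (2ℓ≢0 ∘ λ e → double≡⇒ e (ι-toZ 0)) i))
  where
    2<n : 2 < n
    2<n = ℕ.≤-trans (ℕ.s≤s (ℕ.s≤s (ℕ.s≤s ℕ.z≤n))) 6≤n
    open Setting m n 3≤m 2<n (ℕ.m%n≡0⇒n∣m n 2 n-even) k ℓ (%⇒mod ℓ-parity) k₀≡1 coprime G transitive preserves
    double-K²≡⇒ : ∀ {b c} i → ι b ≡ c mod n → + 2 * (K i * K i) ≡ c mod n → toZ 2 ⊗ (k i ⊗ k i) ≡ b
    double-K²≡⇒ i b≡ e = double≡⇒ (mod-trans (*-congˡ (+ 2) (ι-⊗ (k i) (k i))) e) b≡
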